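{- Let $k \geq 5$ and let $H$ be a finite $k$-uniform hypergraph with $\nu^{(k-2)}(H) = 1$. If there exists an edge $e$ of $H$ such that $|e \cap f| = k-2$ for every other edge $f$ of $H$, then $$\tau^{(k-2)}(H) \leq \left\lceil \frac{\binom{k}{2} + 1}{2}\right\rceil.$$
   Context: For a $k$-uniform hypergraph $H$ with vertex set $V$: a $(k-2)$-matching is a set $M$ of edges with $|f \cap f'| < k-2$ for all distinct $f,f' \in M$, and $\nu^{(k-2)}(H)$ is its maximum size. A $(k-2)$-cover is a set $C$ of $(k-2)$-subsets of $V$ such that every edge contains a member of $C$; $\tau^{(k-2)}(H)$ is the minimum size of a $(k-2)$-cover. -}

module Defs where

open import Data.Nat using (ℕ; _∸_; _<_; _≤_; _+_)
open import Data.Nat.DivMod using (_/_)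
open import Data.Nat.Combinatorics using (_C_)
open import Data.Fin.Subset using (Subset; _∩_; ∣_∣; _⊆_)
open import Data.List using (List; length)
open import Data.List.Membership.Propositional using (_∈_)
open import Data.List.Relation.Unary.All using (All)
open import Data.List.Relation.Unary.Unique.Propositional using (Unique)
open import Data.Product using (Σ; _×_; ∃-syntax)
open import Relation.Binary.PropositionalEquality using (_≡_)
open import Relation.Nullary using (¬_)

record Hypergraph (n k : ℕ) : Set where
  field
    edges   : List (Subset n)
    unique  : Unique edges
    uniform : All (λ e → ∣ e ∣ ≡ k) edges
open Hypergraph public

IsMatching : ∀ {n k} → Hypergraph n k → List (Subset n) → Set
IsMatching {n} {k} H M =
  Unique M × All (λ f → f ∈ edges H) M ×
  (∀ f f' → f ∈ M → f' ∈ M → ¬ f ≡ f' → ∣ f ∩ f' ∣ < k ∸ 2)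

νEq : ∀ {n k} → Hypergraph n k → ℕ → Set
νEq H m =
  (Σ (List _) λ M → IsMatching H M × length M ≡ m) ×
  (∀ M → IsMatching H M → length M ≤ m)

IsCover : ∀ {n k} → Hypergraph n k → List (Subset n) → Set
IsCover {n} {k} H C =
  Unique C × All (λ c → ∣ c ∣ ≡ k ∸ 2) C ×
  All (λ e → ∃[ c ] (c ∈ C × c ⊆ e)) (edges H)

τ≤ : ∀ {n k} → Hypergraph n k → ℕ → Set
τ≤ H m = ∃[ C ] (IsCover H C × length C ≤ m)

-- ⌈ (k choose 2 + 1) / 2 ⌉ = ⌊ (k choose 2 + 2) / 2 ⌋
bound : ℕ → ℕ
bound k = (k C 2 + 2) / 2

{-# OPTIONS --safe #-}
module Submission where

-- Write k = 2 + j, let e be the pivot edge and F the other edges, so that every trace e ∩ f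
-- (f ∈ F) has j elements.  Since ν = 1, any two edges share at least j vertices, so a pair of
-- edges is covered by one j-subset of their intersection.
--
-- If the traces of F are distinct, then |F| ≤ C(k, j) = C(k, 2), and pairing up the edges of H
-- gives a cover of size ⌈(|F| + 1)/2⌉.  Otherwise two distinct twins f₁, f₂ ∈ F share a trace.
-- No g ∈ F contains e ─ f₁ = {a, b}, for then e ⊆ f₁ ∪ g and e ⊆ f₂ ∪ g, and the bound
-- |f ∪ g| ≤ 2k − j = |e| + 2 forces f₁ ─ e = g ─ e = f₂ ─ e, hence f₁ = f₂.  So every trace
-- misses a or b.  If the traces other than e ∩ f₁ are distinct, at most 2(k − 1) edges carry
-- them, and e ∩ f₁ together with a pairing of those edges is a cover of size k.  If instead a
-- second twin pair g₁, g₂ has a different trace, then e ─ f₁ = {u, w} and e ─ g₁ = {u, c} with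
-- w ≠ c, every trace lies in e − u or in e − w − c, and the at most (k − 1) + 1 traces cover H.
-- Finally k ≤ ⌈(C(k, 2) + 1)/2⌉ for k ≥ 4.

open import Defs
import Data.Bool.Properties as Bool
open import Data.Empty using (⊥)
open import Data.Fin.Base using (Fin; zero; suc)
import Data.Fin.Properties as Fin
open import Data.Fin.Subset
  using (Subset; Side; inside; outside; _⊆_; _⊈_; _∩_; _∪_; _─_; _-_; ∣_∣; Nonempty)
  renaming (⊥ to ∅; _∈_ to _∈ₛ_; _∉_ to _∉ₛ_)
open import Data.Fin.Subset.Properties
open import Data.List.Base using (List; []; _∷_; length; map; filter; deduplicate)
open import Data.List.Properties using (length-deduplicate; length-map)
open import Data.List.Membership.Propositional using (_∈_)
open import Data.List.Membership.Propositional.Properties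
  using (∈-map⁻; ∈-map⁺; ∈-filter⁻; ∈-filter⁺; ∈-deduplicate⁺)
import Data.List.Membership.DecPropositional as DecMembership
open import Data.List.Relation.Unary.All as All using (All; []; _∷_)
import Data.List.Relation.Unary.All.Properties as All
import Data.List.Relation.Unary.Any as Any
open import Data.List.Relation.Unary.Unique.Propositional using (Unique; []; _∷_)
import Data.List.Relation.Unary.Unique.Propositional.Properties as Unique
open import Data.Nat.Base hiding (∣_-_∣)
open import Data.Nat.Combinatorics using (_C_; nC1≡n; nCn≡1; nCk≡nC[n∸k]; nCk+nC[k+1]≡[n+1]C[k+1])
open import Data.Nat.DivMod using (_/_; m*n/n≡m; /-monoˡ-≤)
open import Data.Nat.Properties
open import Data.Product using (∃-syntax; _×_; _,_; proj₁; proj₂; map₁; map₂)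
open import Data.Sum using (_⊎_; inj₁; inj₂; fromInj₂)
open import Data.Vec.Base using ([]; _∷_; here; there)
open import Data.Vec.Properties using (≡-dec)
open import Function.Base using (_∘_; flip; case_of_)
open import Relation.Binary.Definitions using (DecidableEquality)
open import Relation.Binary.PropositionalEquality
open import Relation.Nullary using (¬_; yes; no; ¬?; contradiction)
open import Relation.Unary using (Decidable)

private variable
  n : ℕ
  p q r : Subset n
  x y : Fin n

infix 4 _≟ₛ_
_≟ₛ_ : DecidableEquality (Subset n)
_≟ₛ_ = ≡-dec Bool._≟_

x∈p─q⇒x∉q : x ∈ₛ p ─ q → x ∉ₛ q
x∈p─q⇒x∉q {p = inside ∷ _} {q = outside ∷ _} here ()
x∈p─q⇒x∉q {p = _ ∷ _} {q = _ ∷ _} (there x∈p─q) (there x∈q) = x∈p─q⇒x∉q x∈p─q x∈q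

x∈p-y⇒x≢y : x ∈ₛ p - y → x ≢ y
x∈p-y⇒x≢y = x∉⁅y⁆⇒x≢y ∘ x∈p─q⇒x∉q

⊈⇒∃∉ : p ⊈ q → ∃[ x ] (x ∈ₛ p × x ∉ₛ q)
⊈⇒∃∉ {p = []} {q = []} p⊈q = contradiction (λ ()) p⊈q
⊈⇒∃∉ {p = inside ∷ p} {q = outside ∷ q} p⊈q = zero , here , λ ()
⊈⇒∃∉ {p = inside ∷ p} {q = inside ∷ q} p⊈q with ⊈⇒∃∉ (p⊈q ∘ in⊆in)
... | x , x∈p , x∉q = suc x , there x∈p , x∉q ∘ drop-there
⊈⇒∃∉ {p = outside ∷ p} {q = _ ∷ q} p⊈q with ⊈⇒∃∉ (p⊈q ∘ out⊆)
... | x , x∈p , x∉q = suc x , there x∈p , x∉q ∘ drop-there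

p─q⊆r⇒p⊆q∪r : p ─ q ⊆ r → p ⊆ q ∪ r
p─q⊆r⇒p⊆q∪r {q = q} p─q⊆r {x} x∈p with x ∈? q
... | yes x∈q = x∈p∪q⁺ (inj₁ x∈q)
... | no x∉q = x∈p∪q⁺ (inj₂ (p─q⊆r (x∈p∧x∉q⇒x∈p─q x∈p x∉q)))

p⊆q⇒p─r⊆q─r : p ⊆ q → p ─ r ⊆ q ─ r
p⊆q⇒p─r⊆q─r {p = p} {r = r} p⊆q x∈p─r = x∈p∧x∉q⇒x∈p─q (p⊆q (p─q⊆p p r x∈p─r)) (x∈p─q⇒x∉q x∈p─r)

x∉q⇒p∩q⊆p-x : x ∉ₛ q → p ∩ q ⊆ p - x
x∉q⇒p∩q⊆p-x x∉q y∈p∩q with x∈p∩q⁻ _ _ y∈p∩q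
... | y∈p , y∈q = x∈p∧x≢y⇒x∈p-y y∈p λ { refl → x∉q y∈q }

x∉q⇒y∉q⇒p∩q⊆p-x-y : x ∉ₛ q → y ∉ₛ q → p ∩ q ⊆ p - x - y
x∉q⇒y∉q⇒p∩q⊆p-x-y x∉q y∉q z∈p∩q =
  x∈p∧x≢y⇒x∈p-y (x∉q⇒p∩q⊆p-x x∉q z∈p∩q) λ { refl → y∉q (proj₂ (x∈p∩q⁻ _ _ z∈p∩q)) }

p─[p∩q]≡p─q : ∀ (p q : Subset n) → p ─ (p ∩ q) ≡ p ─ q
p─[p∩q]≡p─q [] [] = refl
p─[p∩q]≡p─q (inside ∷ p) (inside ∷ q) = cong (outside ∷_) (p─[p∩q]≡p─q p q)
p─[p∩q]≡p─q (inside ∷ p) (outside ∷ q) = cong (inside ∷_) (p─[p∩q]≡p─q p q)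
p─[p∩q]≡p─q (outside ∷ p) (inside ∷ q) = cong (outside ∷_) (p─[p∩q]≡p─q p q)
p─[p∩q]≡p─q (outside ∷ p) (outside ∷ q) = cong (outside ∷_) (p─[p∩q]≡p─q p q)

p─[p─q]≡p∩q : ∀ (p q : Subset n) → p ─ (p ─ q) ≡ p ∩ q
p─[p─q]≡p∩q [] [] = refl
p─[p─q]≡p∩q (inside ∷ p) (inside ∷ q) = cong (inside ∷_) (p─[p─q]≡p∩q p q)
p─[p─q]≡p∩q (inside ∷ p) (outside ∷ q) = cong (outside ∷_) (p─[p─q]≡p∩q p q)
p─[p─q]≡p∩q (outside ∷ p) (inside ∷ q) = cong (outside ∷_) (p─[p─q]≡p∩q p q)
p─[p─q]≡p∩q (outside ∷ p) (outside ∷ q) = cong (outside ∷_) (p─[p─q]≡p∩q p q)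

p∩q≡p∩r⇒p─q≡p─r : ∀ p → p ∩ q ≡ p ∩ r → p ─ q ≡ p ─ r
p∩q≡p∩r⇒p─q≡p─r {q = q} {r = r} p p∩q≡p∩r =
  trans (sym (p─[p∩q]≡p─q p q)) (trans (cong (p ─_) p∩q≡p∩r) (p─[p∩q]≡p─q p r))

p─q≡p─r⇒p∩q≡p∩r : ∀ p → p ─ q ≡ p ─ r → p ∩ q ≡ p ∩ r
p─q≡p─r⇒p∩q≡p∩r {q = q} {r = r} p p─q≡p─r =
  trans (sym (p─[p─q]≡p∩q p q)) (trans (cong (p ─_) p─q≡p─r) (p─[p─q]≡p∩q p r))

p∩q∪q─p≡q : ∀ (p q : Subset n) → (p ∩ q) ∪ (q ─ p) ≡ q
p∩q∪q─p≡q [] [] = refl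
p∩q∪q─p≡q (inside ∷ p) (inside ∷ q) = cong (inside ∷_) (p∩q∪q─p≡q p q)
p∩q∪q─p≡q (inside ∷ p) (outside ∷ q) = cong (outside ∷_) (p∩q∪q─p≡q p q)
p∩q∪q─p≡q (outside ∷ p) (inside ∷ q) = cong (inside ∷_) (p∩q∪q─p≡q p q)
p∩q∪q─p≡q (outside ∷ p) (outside ∷ q) = cong (outside ∷_) (p∩q∪q─p≡q p q)

∣p∩q∣+∣p─q∣≡∣p∣ : ∀ (p q : Subset n) → ∣ p ∩ q ∣ + ∣ p ─ q ∣ ≡ ∣ p ∣
∣p∩q∣+∣p─q∣≡∣p∣ [] [] = refl
∣p∩q∣+∣p─q∣≡∣p∣ (inside ∷ p) (inside ∷ q) = cong suc (∣p∩q∣+∣p─q∣≡∣p∣ p q)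
∣p∩q∣+∣p─q∣≡∣p∣ (inside ∷ p) (outside ∷ q) = trans (+-suc _ _) (cong suc (∣p∩q∣+∣p─q∣≡∣p∣ p q))
∣p∩q∣+∣p─q∣≡∣p∣ (outside ∷ p) (inside ∷ q) = ∣p∩q∣+∣p─q∣≡∣p∣ p q
∣p∩q∣+∣p─q∣≡∣p∣ (outside ∷ p) (outside ∷ q) = ∣p∩q∣+∣p─q∣≡∣p∣ p q

∣p∪q∣+∣p∩q∣≡∣p∣+∣q∣ : ∀ (p q : Subset n) → ∣ p ∪ q ∣ + ∣ p ∩ q ∣ ≡ ∣ p ∣ + ∣ q ∣
∣p∪q∣+∣p∩q∣≡∣p∣+∣q∣ [] [] = refl
∣p∪q∣+∣p∩q∣≡∣p∣+∣q∣ (inside ∷ p) (inside ∷ q) =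
  cong suc (trans (+-suc _ _) (trans (cong suc (∣p∪q∣+∣p∩q∣≡∣p∣+∣q∣ p q)) (sym (+-suc _ _))))
∣p∪q∣+∣p∩q∣≡∣p∣+∣q∣ (inside ∷ p) (outside ∷ q) = cong suc (∣p∪q∣+∣p∩q∣≡∣p∣+∣q∣ p q)
∣p∪q∣+∣p∩q∣≡∣p∣+∣q∣ (outside ∷ p) (inside ∷ q) =
  trans (cong suc (∣p∪q∣+∣p∩q∣≡∣p∣+∣q∣ p q)) (sym (+-suc _ _))
∣p∪q∣+∣p∩q∣≡∣p∣+∣q∣ (outside ∷ p) (outside ∷ q) = ∣p∪q∣+∣p∩q∣≡∣p∣+∣q∣ p q

∣p─q∣≡∣p∣∸∣p∩q∣ : ∀ (p q : Subset n) → ∣ p ─ q ∣ ≡ ∣ p ∣ ∸ ∣ p ∩ q ∣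
∣p─q∣≡∣p∣∸∣p∩q∣ p q = begin
  ∣ p ─ q ∣                         ≡⟨ m+n∸m≡n ∣ p ∩ q ∣ ∣ p ─ q ∣ ⟨
  ∣ p ∩ q ∣ + ∣ p ─ q ∣ ∸ ∣ p ∩ q ∣  ≡⟨ cong (_∸ ∣ p ∩ q ∣) (∣p∩q∣+∣p─q∣≡∣p∣ p q) ⟩
  ∣ p ∣ ∸ ∣ p ∩ q ∣                 ∎
  where open ≡-Reasoning

x∈p⇒suc∣p-x∣≡∣p∣ : x ∈ₛ p → suc ∣ p - x ∣ ≡ ∣ p ∣
x∈p⇒suc∣p-x∣≡∣p∣ {p = inside ∷ p} here = cong (suc ∘ ∣_∣) (p─⊥≡p p)
x∈p⇒suc∣p-x∣≡∣p∣ {p = inside ∷ p} (there x∈p) = cong suc (x∈p⇒suc∣p-x∣≡∣p∣ x∈p)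
x∈p⇒suc∣p-x∣≡∣p∣ {p = outside ∷ p} (there x∈p) = x∈p⇒suc∣p-x∣≡∣p∣ x∈p

p⊆q⇒∣q∣≤∣p∣⇒p≡q : p ⊆ q → ∣ q ∣ ≤ ∣ p ∣ → p ≡ q
p⊆q⇒∣q∣≤∣p∣⇒p≡q {p = p} {q = q} p⊆q ∣q∣≤∣p∣ with q ⊆? p
... | yes q⊆p = ⊆-antisym p⊆q q⊆p
... | no q⊈p = contradiction ∣q∣≤∣p∣ (<⇒≱ (p⊂q⇒∣p∣<∣q∣ (p⊆q , ⊈⇒∃∉ q⊈p)))

x∈p⇒0<∣p∣ : x ∈ₛ p → 0 < ∣ p ∣
x∈p⇒0<∣p∣ x∈p = subst (0 <_) (x∈p⇒suc∣p-x∣≡∣p∣ x∈p) z<s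

0<∣p∣⇒nonempty : 0 < ∣ p ∣ → Nonempty p
0<∣p∣⇒nonempty {p = inside ∷ p} _ = zero , here
0<∣p∣⇒nonempty {p = outside ∷ p} 0<∣p∣ with 0<∣p∣⇒nonempty 0<∣p∣
... | x , x∈p = suc x , there x∈p

∣p∣≡1⇒x∈p⇒y∈p⇒x≡y : ∣ p ∣ ≡ 1 → x ∈ₛ p → y ∈ₛ p → x ≡ y
∣p∣≡1⇒x∈p⇒y∈p⇒x≡y {p = p} {x = x} {y = y} ∣p∣≡1 x∈p y∈p with x Fin.≟ y
... | yes x≡y = x≡y
... | no x≢y = contradiction (s≤s⁻¹ (subst (∣ p - x ∣ <_) ∣p∣≡1 (x∈p⇒∣p-x∣<∣p∣ x∈p)))
                            (<⇒≱ (x∈p⇒0<∣p∣ (x∈p∧x≢y⇒x∈p-y y∈p (x≢y ∘ sym))))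

∣p∣≡2⇒partner : ∣ p ∣ ≡ 2 → x ∈ₛ p →
                ∃[ y ] (y ∈ₛ p × y ≢ x × (∀ {z} → z ∈ₛ p → z ≢ x → z ≡ y))
∣p∣≡2⇒partner {p = p} {x = x} ∣p∣≡2 x∈p =
  let ∣p-x∣≡1 = suc-injective (trans (x∈p⇒suc∣p-x∣≡∣p∣ x∈p) ∣p∣≡2)
      y , y∈p-x = 0<∣p∣⇒nonempty (subst (0 <_) (sym ∣p-x∣≡1) z<s)
  in  y , p─q⊆p p _ y∈p-x , x∈p-y⇒x≢y y∈p-x ,
      λ z∈p z≢x → ∣p∣≡1⇒x∈p⇒y∈p⇒x≡y ∣p-x∣≡1 (x∈p∧x≢y⇒x∈p-y z∈p z≢x) y∈p-x

missed-partner : (∀ {z} → z ∈ₛ p → z ≢ x → z ≡ y) → ∃[ v ] (v ∈ₛ p × v ∉ₛ q) → x ∈ₛ q → y ∉ₛ q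
missed-partner p∖x⊆y (v , v∈p , v∉q) x∈q = subst (_∉ₛ _) (p∖x⊆y v∈p λ { refl → v∉q x∈q }) v∉q

⊆-of-size : ∀ r (p : Subset n) → r ≤ ∣ p ∣ → ∃[ q ] (q ⊆ p × ∣ q ∣ ≡ r)
⊆-of-size {n} zero p _ = ∅ , ⊥⊆ , ∣⊥∣≡0 n
⊆-of-size (suc r) (inside ∷ p) r<∣p∣ =
  let q , q⊆p , ∣q∣≡r = ⊆-of-size r p (s≤s⁻¹ r<∣p∣) in inside ∷ q , in⊆in q⊆p , cong suc ∣q∣≡r
⊆-of-size (suc r) (outside ∷ p) r<∣p∣ =
  let q , q⊆p , ∣q∣≡r = ⊆-of-size (suc r) p r<∣p∣ in outside ∷ q , out⊆ q⊆p , ∣q∣≡r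

-- |f ∪ g| = |f| + |g| − |f ∩ g| ≤ |e| + 2, so (f ∪ g) ─ e has at most two elements, and it
-- contains both two-element sets f ─ e and g ─ e.
e⊆f∪g⇒f─e≡g─e : ∀ {j} {e f g : Subset n} → ∣ e ∣ ≡ 2 + j → ∣ f ∣ ≡ 2 + j → ∣ g ∣ ≡ 2 + j →
                j ≤ ∣ f ∩ g ∣ → ∣ f ─ e ∣ ≡ 2 → ∣ g ─ e ∣ ≡ 2 → e ⊆ f ∪ g → f ─ e ≡ g ─ e
e⊆f∪g⇒f─e≡g─e {j = j} {e} {f} {g} ∣e∣ ∣f∣ ∣g∣ j≤∣f∩g∣ ∣f─e∣ ∣g─e∣ e⊆f∪g =
  trans (fills (p⊆p∪q g) ∣f─e∣) (sym (fills (q⊆p∪q f g) ∣g─e∣))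
  where
  ∣f∪g─e∣≤2 : ∣ (f ∪ g) ─ e ∣ ≤ 2
  ∣f∪g─e∣≤2 = +-cancelʳ-≤ j _ _ (+-cancelˡ-≤ (2 + j) _ _ (begin
    (2 + j) + (∣ (f ∪ g) ─ e ∣ + j)                 ≡⟨ +-assoc (2 + j) _ j ⟨
    (2 + j) + ∣ (f ∪ g) ─ e ∣ + j                   ≤⟨ +-mono-≤ (+-monoˡ-≤ _ 2+j≤∣[f∪g]∩e∣) j≤∣f∩g∣ ⟩
    ∣ (f ∪ g) ∩ e ∣ + ∣ (f ∪ g) ─ e ∣ + ∣ f ∩ g ∣   ≡⟨ cong (_+ ∣ f ∩ g ∣) (∣p∩q∣+∣p─q∣≡∣p∣ (f ∪ g) e) ⟩
    ∣ f ∪ g ∣ + ∣ f ∩ g ∣                           ≡⟨ ∣p∪q∣+∣p∩q∣≡∣p∣+∣q∣ f g ⟩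
    ∣ f ∣ + ∣ g ∣                                   ≡⟨ cong₂ _+_ ∣f∣ ∣g∣ ⟩
    (2 + j) + (2 + j)                               ∎))
    where
    open ≤-Reasoning
    2+j≤∣[f∪g]∩e∣ : 2 + j ≤ ∣ (f ∪ g) ∩ e ∣
    2+j≤∣[f∪g]∩e∣ = subst (_≤ ∣ (f ∪ g) ∩ e ∣) ∣e∣ (p⊆q⇒∣p∣≤∣q∣ (λ x∈e → x∈p∩q⁺ (e⊆f∪g x∈e , x∈e)))
  fills : ∀ {h} → h ⊆ f ∪ g → ∣ h ─ e ∣ ≡ 2 → h ─ e ≡ (f ∪ g) ─ e
  fills h⊆f∪g ∣h─e∣ = p⊆q⇒∣q∣≤∣p∣⇒p≡q (p⊆q⇒p─r⊆q─r h⊆f∪g) (subst (_ ≤_) (sym ∣h─e∣) ∣f∪g─e∣≤2)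

select : Side → List (Subset (suc n)) → List (Subset n)
select s [] = []
select s ((x ∷ c) ∷ L) with x Bool.≟ s
... | yes _ = c ∷ select s L
... | no _ = select s L

length-select : ∀ (L : List (Subset (suc n))) →
                length L ≡ length (select inside L) + length (select outside L)
length-select [] = refl
length-select ((inside ∷ c) ∷ L) = cong suc (length-select L)
length-select ((outside ∷ c) ∷ L) = trans (cong suc (length-select L)) (sym (+-suc _ _))

module _ {P : Subset (suc n) → Set} {Q : Subset n → Set} {s : Side} where

  select-All : (∀ {c} → P (s ∷ c) → Q c) → ∀ {L} → All P L → All Q (select s L)
  select-All f {[]} [] = []
  select-All f {(x ∷ c) ∷ L} (px ∷ pL) with x Bool.≟ s
  ... | yes refl = f px ∷ select-All f pL
  ... | no _ = select-All f pL

select-Unique : ∀ {s} {L : List (Subset (suc n))} → Unique L → Unique (select s L)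
select-Unique {L = []} [] = []
select-Unique {s = s} {L = (x ∷ c) ∷ L} (x∷c∉L ∷ u) with x Bool.≟ s
... | yes refl = select-All (λ ≢ → ≢ ∘ cong (s ∷_)) x∷c∉L ∷ select-Unique u
... | no _ = select-Unique u

All-⊥⇒length≡0 : ∀ {A : Set} {xs : List A} → All (λ _ → ⊥) xs → length xs ≡ 0
All-⊥⇒length≡0 [] = refl

length≤∣s∣Cr : ∀ (s : Subset n) r {L} → Unique L → All (λ c → c ⊆ s × ∣ c ∣ ≡ r) L →
               length L ≤ ∣ s ∣ C r
length≤∣s∣Cr [] r {[]} _ _ = z≤n
length≤∣s∣Cr [] .0 {[] ∷ []} _ ((_ , refl) ∷ []) = ≤-refl
length≤∣s∣Cr [] r {[] ∷ [] ∷ _} (([]≢[] ∷ _) ∷ _) _ = contradiction refl []≢[]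
length≤∣s∣Cr (b ∷ s) r {L} u L⊆ = begin
  length L                                              ≡⟨ length-select L ⟩
  length (select inside L) + length (select outside L)  ≤⟨ +-monoʳ-≤ _ outsides ⟩
  length (select inside L) + ∣ s ∣ C r                  ≤⟨ insides b r L⊆ ⟩
  ∣ b ∷ s ∣ C r                                         ∎
  where
  open ≤-Reasoning
  outsides : length (select outside L) ≤ ∣ s ∣ C r
  outsides = length≤∣s∣Cr s r (select-Unique u) (select-All (λ (c⊆ , ∣c∣) → drop-∷-⊆ c⊆ , ∣c∣) L⊆)
  insides : ∀ b′ r′ → All (λ c → c ⊆ b′ ∷ s × ∣ c ∣ ≡ r′) L →
            length (select inside L) + ∣ s ∣ C r′ ≤ ∣ b′ ∷ s ∣ C r′
  insides outside _ L⊆′ =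
    ≤-reflexive (cong (_+ _) (All-⊥⇒length≡0 (select-All (λ (c⊆ , _) → case c⊆ here of λ ()) L⊆′)))
  insides inside zero L⊆′ =
    ≤-reflexive (cong (_+ _) (All-⊥⇒length≡0 (select-All (λ { (_ , ()) }) L⊆′)))
  insides inside (suc r′) L⊆′ = begin
    length (select inside L) + ∣ s ∣ C suc r′
      ≤⟨ +-monoˡ-≤ _ (length≤∣s∣Cr s r′ (select-Unique u)
                        (select-All (λ (c⊆ , ∣c∣) → drop-∷-⊆ c⊆ , suc-injective ∣c∣) L⊆′)) ⟩
    ∣ s ∣ C r′ + ∣ s ∣ C suc r′  ≡⟨ nCk+nC[k+1]≡[n+1]C[k+1] ∣ s ∣ r′ ⟩
    suc ∣ s ∣ C suc r′           ∎

module _ {A : Set} {P : A → Set} (P? : Decidable P) where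

  length-filter+filter-¬≡length : ∀ xs →
                                  length (filter P? xs) + length (filter (¬? ∘ P?) xs) ≡ length xs
  length-filter+filter-¬≡length [] = refl
  length-filter+filter-¬≡length (x ∷ xs) with P? x
  ... | yes _ = cong suc (length-filter+filter-¬≡length xs)
  ... | no _ = trans (+-suc _ _) (cong suc (length-filter+filter-¬≡length xs))

length≤∣s∣Cr+∣t∣Cr : ∀ (s t : Subset n) r {L} → Unique L → All (λ c → (c ⊆ s ⊎ c ⊆ t) × ∣ c ∣ ≡ r) L →
                     length L ≤ ∣ s ∣ C r + ∣ t ∣ C r
length≤∣s∣Cr+∣t∣Cr s t r {L} u L⊆ = begin
  length L                                                  ≡⟨ length-filter+filter-¬≡length ⊆s? L ⟨
  length (filter ⊆s? L) + length (filter (¬? ∘ ⊆s?) L)      ≤⟨ +-mono-≤ in-s in-t ⟩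
  ∣ s ∣ C r + ∣ t ∣ C r                                     ∎
  where
  open ≤-Reasoning
  ⊆s? = _⊆? s
  in-s : length (filter ⊆s? L) ≤ ∣ s ∣ C r
  in-s = length≤∣s∣Cr s r (Unique.filter⁺ ⊆s? u)
           (All.zipWith (map₂ proj₂) (All.all-filter ⊆s? L , All.filter⁺ ⊆s? L⊆))
  in-t : length (filter (¬? ∘ ⊆s?) L) ≤ ∣ t ∣ C r
  in-t = length≤∣s∣Cr t r (Unique.filter⁺ (¬? ∘ ⊆s?) u)
           (All.zipWith (λ (c⊈s , c∈) → map₁ (fromInj₂ (flip contradiction c⊈s)) c∈)
                        (All.all-filter (¬? ∘ ⊆s?) L , All.filter⁺ (¬? ∘ ⊆s?) L⊆))

deduplicate-Unique : ∀ (L : List (Subset n)) → Unique (deduplicate _≟ₛ_ L)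
deduplicate-Unique [] = []
deduplicate-Unique (c ∷ L) =
  All.all-filter (¬? ∘ (c ≟ₛ_)) (deduplicate _≟ₛ_ L) ∷
  Unique.filter⁺ (¬? ∘ (c ≟ₛ_)) (deduplicate-Unique L)

module _ {A B : Set} (_≟_ : DecidableEquality B) (h : A → B) where
  open DecMembership _≟_ using () renaming (_∈?_ to _∈ₗ?_)

  Collision : List A → Set
  Collision xs = ∃[ x ] ∃[ y ] (x ∈ xs × y ∈ xs × x ≢ y × h x ≡ h y)

  Unique-map⊎Collision : ∀ {xs} → Unique xs → Unique (map h xs) ⊎ Collision xs
  Unique-map⊎Collision {[]} [] = inj₁ []
  Unique-map⊎Collision {x ∷ xs} (x∉xs ∷ u) with Unique-map⊎Collision u | h x ∈ₗ? map h xs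
  ... | inj₂ (y , z , y∈ , z∈ , y≢z , hy≡hz) | _ =
    inj₂ (y , z , Any.there y∈ , Any.there z∈ , y≢z , hy≡hz)
  ... | inj₁ _ | yes hx∈ =
    let y , y∈xs , hx≡hy = ∈-map⁻ h hx∈
    in  inj₂ (x , y , Any.here refl , Any.there y∈xs , All.lookup x∉xs y∈xs , hx≡hy)
  ... | inj₁ u′ | no hx∉ = inj₁ (All.¬Any⇒All¬ _ hx∉ ∷ u′)

m*2≤n⇒m≤n/2 : ∀ {m} n → m * 2 ≤ n → m ≤ n / 2
m*2≤n⇒m≤n/2 {m} n m*2≤n = subst (_≤ n / 2) (m*n/n≡m m 2) (/-monoˡ-≤ 2 m*2≤n)

⌈n/2⌉*2≤1+n : ∀ n → ⌈ n /2⌉ * 2 ≤ suc n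
⌈n/2⌉*2≤1+n zero = z≤n
⌈n/2⌉*2≤1+n (suc zero) = ≤-refl
⌈n/2⌉*2≤1+n (suc (suc n)) = s≤s (s≤s (⌈n/2⌉*2≤1+n n))

m≤n⇒⌈1+m/2⌉≤[n+2]/2 : ∀ {m n} → m ≤ n → ⌈ suc m /2⌉ ≤ (n + 2) / 2
m≤n⇒⌈1+m/2⌉≤[n+2]/2 {m} {n} m≤n =
  m*2≤n⇒m≤n/2 (n + 2)
    (≤-trans (⌈n/2⌉*2≤1+n (suc m)) (≤-trans (s≤s (s≤s m≤n)) (≤-reflexive (+-comm 2 n))))

[1+n]Cn≡1+n : ∀ n → suc n C n ≡ suc n
[1+n]Cn≡1+n n = trans (nCk≡nC[n∸k] (n≤1+n n)) (trans (cong (suc n C_) (m+n∸n≡m 1 n)) (nC1≡n (suc n)))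

[2+n]Cn≡[2+n]C2 : ∀ n → (2 + n) C n ≡ (2 + n) C 2
[2+n]Cn≡[2+n]C2 n = trans (nCk≡nC[n∸k] (m≤n+m n 2)) (cong ((2 + n) C_) (m+n∸n≡m 2 n))

[4+i]*2≤[4+i]C2+2 : ∀ i → (4 + i) * 2 ≤ (4 + i) C 2 + 2
[4+i]*2≤[4+i]C2+2 zero = ≤-refl
[4+i]*2≤[4+i]C2+2 (suc i) = begin
  2 + k * 2               ≤⟨ +-monoʳ-≤ 2 ([4+i]*2≤[4+i]C2+2 i) ⟩
  2 + (k C 2 + 2)         ≤⟨ +-monoˡ-≤ _ (m≤m+n 2 (2 + i)) ⟩
  k + (k C 2 + 2)         ≡⟨ +-assoc k (k C 2) 2 ⟨
  k + k C 2 + 2           ≡⟨ cong (λ m → m + k C 2 + 2) (nC1≡n k) ⟨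
  k C 1 + k C 2 + 2       ≡⟨ cong (_+ 2) (nCk+nC[k+1]≡[n+1]C[k+1] k 1) ⟩
  suc k C 2 + 2           ∎
  where
  open ≤-Reasoning
  k = 4 + i

4≤k⇒k≤bound : ∀ {k} → 4 ≤ k → k ≤ bound k
4≤k⇒k≤bound 4≤k with m≤n⇒∃[o]m+o≡n 4≤k
... | i , refl = m*2≤n⇒m≤n/2 _ ([4+i]*2≤[4+i]C2+2 i)

Covers : List (Subset n) → Subset n → Set
Covers cs f = ∃[ c ] (c ∈ cs × c ⊆ f)

pairing-cover : ∀ r (L : List (Subset n)) → (∀ {f g} → f ∈ L → g ∈ L → r ≤ ∣ f ∩ g ∣) →
                ∃[ cs ] (All (λ c → ∣ c ∣ ≡ r) cs × All (Covers cs) L × length cs ≤ ⌈ length L /2⌉)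
pairing-cover r [] _ = [] , [] , [] , z≤n
pairing-cover r (f ∷ []) meets =
  let c , c⊆f∩f , ∣c∣ = ⊆-of-size r (f ∩ f) (meets (Any.here refl) (Any.here refl))
  in  c ∷ [] , ∣c∣ ∷ [] , (c , Any.here refl , p∩q⊆p f f ∘ c⊆f∩f) ∷ [] , ≤-refl
pairing-cover r (f ∷ g ∷ L) meets =
  let c , c⊆f∩g , ∣c∣ = ⊆-of-size r (f ∩ g) (meets (Any.here refl) (Any.there (Any.here refl)))
      cs , ∣cs∣ , covers , len =
        pairing-cover r L (λ f∈L g∈L → meets (Any.there (Any.there f∈L)) (Any.there (Any.there g∈L)))
  in  c ∷ cs , ∣c∣ ∷ ∣cs∣ ,
      (c , Any.here refl , p∩q⊆p f g ∘ c⊆f∩g) ∷ (c , Any.here refl , p∩q⊆q f g ∘ c⊆f∩g) ∷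
        All.map (map₂ (map₁ Any.there)) covers ,
      s≤s len

module _ {k} (H : Hypergraph n k) where

  τ≤-intro : ∀ {m} cs → All (λ c → ∣ c ∣ ≡ k ∸ 2) cs → (∀ {f} → f ∈ edges H → Covers cs f) →
             length cs ≤ m → τ≤ H m
  τ≤-intro cs ∣cs∣ covers len =
    deduplicate _≟ₛ_ cs ,
    (deduplicate-Unique cs , All.deduplicate⁺ _≟ₛ_ ∣cs∣ ,
     All.tabulate (map₂ (map₁ (∈-deduplicate⁺ _≟ₛ_)) ∘ covers)) ,
    ≤-trans (length-deduplicate _≟ₛ_ cs) len

  τ≤-mono : ∀ {m m′} → τ≤ H m → m ≤ m′ → τ≤ H m′
  τ≤-mono (cs , cover , len) m≤m′ = cs , cover , ≤-trans len m≤m′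

  ν≡1⇒k∸2≤∣f∩g∣ : νEq H 1 → ∀ {f g} → f ∈ edges H → g ∈ edges H → k ∸ 2 ≤ ∣ f ∩ g ∣
  ν≡1⇒k∸2≤∣f∩g∣ ν {f} {g} f∈H g∈H with f ≟ₛ g | ∣ f ∩ g ∣ <? k ∸ 2
  ... | yes refl | _ = subst (k ∸ 2 ≤_) (sym ∣f∩f∣≡k) (m∸n≤m k 2)
    where ∣f∩f∣≡k = trans (cong ∣_∣ (∩-idem f)) (All.lookup (uniform H) f∈H)
  ... | no _ | no ≮ = ≮⇒≥ ≮
  ... | no f≢g | yes small = contradiction (proj₂ ν (f ∷ g ∷ []) matching) λ { (s≤s ()) }
    where
    matching : IsMatching H (f ∷ g ∷ [])
    matching = ((f≢g ∷ []) ∷ [] ∷ []) , (f∈H ∷ g∈H ∷ []) , apart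
      where
      apart : ∀ h h′ → h ∈ f ∷ g ∷ [] → h′ ∈ f ∷ g ∷ [] → h ≢ h′ → ∣ h ∩ h′ ∣ < k ∸ 2
      apart _ _ (Any.here refl) (Any.here refl) h≢h = contradiction refl h≢h
      apart _ _ (Any.here refl) (Any.there (Any.here refl)) _ = small
      apart _ _ (Any.there (Any.here refl)) (Any.here refl) _ =
        subst (_< k ∸ 2) (cong ∣_∣ (∩-comm f g)) small
      apart _ _ (Any.there (Any.here refl)) (Any.there (Any.here refl)) h≢h = contradiction refl h≢h

module Pivot {n j} (H : Hypergraph n (2 + j)) (ν : νEq H 1) {e : Subset n} (e∈H : e ∈ edges H)
             (pivot : ∀ f → f ∈ edges H → f ≢ e → ∣ e ∩ f ∣ ≡ j) where

  E F : List (Subset n)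
  E = edges H
  F = filter (¬? ∘ (_≟ₛ e)) E

  private variable f g : Subset n

  ∣f∣≡2+j : f ∈ E → ∣ f ∣ ≡ 2 + j
  ∣f∣≡2+j = All.lookup (uniform H)

  ∣e∣≡2+j : ∣ e ∣ ≡ 2 + j
  ∣e∣≡2+j = ∣f∣≡2+j e∈H

  j≤∣f∩g∣ : f ∈ E → g ∈ E → j ≤ ∣ f ∩ g ∣
  j≤∣f∩g∣ = ν≡1⇒k∸2≤∣f∩g∣ H ν

  F⊆E : f ∈ F → f ∈ E
  F⊆E = proj₁ ∘ ∈-filter⁻ (¬? ∘ (_≟ₛ e))

  F-unique : Unique F
  F-unique = Unique.filter⁺ (¬? ∘ (_≟ₛ e)) (unique H)

  ∣e∩f∣≡j : f ∈ F → ∣ e ∩ f ∣ ≡ j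
  ∣e∩f∣≡j f∈F = let f∈E , f≢e = ∈-filter⁻ (¬? ∘ (_≟ₛ e)) f∈F in pivot _ f∈E f≢e

  ∣e─f∣≡2 : f ∈ F → ∣ e ─ f ∣ ≡ 2
  ∣e─f∣≡2 {f} f∈F = begin
    ∣ e ─ f ∣          ≡⟨ ∣p─q∣≡∣p∣∸∣p∩q∣ e f ⟩
    ∣ e ∣ ∸ ∣ e ∩ f ∣  ≡⟨ cong₂ _∸_ ∣e∣≡2+j (∣e∩f∣≡j f∈F) ⟩
    2 + j ∸ j          ≡⟨ m+n∸n≡m 2 j ⟩
    2                  ∎
    where open ≡-Reasoning

  ∣f─e∣≡2 : f ∈ F → ∣ f ─ e ∣ ≡ 2
  ∣f─e∣≡2 {f} f∈F = begin
    ∣ f ─ e ∣          ≡⟨ ∣p─q∣≡∣p∣∸∣p∩q∣ f e ⟩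
    ∣ f ∣ ∸ ∣ f ∩ e ∣  ≡⟨ cong₂ _∸_ (∣f∣≡2+j (F⊆E f∈F))
                                    (trans (cong ∣_∣ (∩-comm f e)) (∣e∩f∣≡j f∈F)) ⟩
    2 + j ∸ j          ≡⟨ m+n∸n≡m 2 j ⟩
    2                  ∎
    where open ≡-Reasoning

  ∣e-x∣≡1+j : ∀ {x} → x ∈ₛ e → ∣ e - x ∣ ≡ suc j
  ∣e-x∣≡1+j x∈e = suc-injective (trans (x∈p⇒suc∣p-x∣≡∣p∣ x∈e) ∣e∣≡2+j)

  covers-E : ∀ {cs} → Covers cs e → (∀ {f} → f ∈ F → Covers cs f) → ∀ {f} → f ∈ E → Covers cs f
  covers-E covers-e covers-F {f} f∈E with f ≟ₛ e
  ... | yes refl = covers-e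
  ... | no f≢e = covers-F (∈-filter⁺ (¬? ∘ (_≟ₛ e)) f∈E f≢e)

  τ≤-distinct-traces : Unique (map (e ∩_) F) → τ≤ H (bound (2 + j))
  τ≤-distinct-traces distinct =
    let cs , ∣cs∣ , covers , len = pairing-cover j (e ∷ F) (λ f∈ g∈ → j≤∣f∩g∣ (e∷F⊆E f∈) (e∷F⊆E g∈))
    in  τ≤-intro H cs ∣cs∣ (covers-E (All.head covers) (All.lookup (All.tail covers)))
                  (≤-trans len (m≤n⇒⌈1+m/2⌉≤[n+2]/2 ∣F∣≤kC2))
    where
    e∷F⊆E : f ∈ e ∷ F → f ∈ E
    e∷F⊆E (Any.here refl) = e∈H
    e∷F⊆E (Any.there f∈F) = F⊆E f∈F
    ∣F∣≤kC2 : length F ≤ (2 + j) C 2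
    ∣F∣≤kC2 = begin
      length F                ≡⟨ length-map (e ∩_) F ⟨
      length (map (e ∩_) F)   ≤⟨ length≤∣s∣Cr e j distinct
                                   (All.map⁺ (All.tabulate λ {f} f∈F → p∩q⊆p e f , ∣e∩f∣≡j f∈F)) ⟩
      ∣ e ∣ C j               ≡⟨ cong (_C j) ∣e∣≡2+j ⟩
      (2 + j) C j             ≡⟨ [2+n]Cn≡[2+n]C2 j ⟩
      (2 + j) C 2             ∎
      where open ≤-Reasoning

  τ≤-traces : ∀ {f₀ s t} → f₀ ∈ F → (∀ {g} → g ∈ F → e ∩ g ⊆ s ⊎ e ∩ g ⊆ t) →
              τ≤ H (∣ s ∣ C j + ∣ t ∣ C j)
  τ≤-traces {f₀} {s} {t} f₀∈F trace⊆ =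
    τ≤-intro H traces (All.deduplicate⁺ _≟ₛ_ (All.map⁺ (All.tabulate ∣e∩f∣≡j)))
             (covers-E (trace-covers f₀∈F (p∩q⊆p e f₀)) (λ {g} g∈F → trace-covers g∈F (p∩q⊆q e g)))
             (length≤∣s∣Cr+∣t∣Cr s t j (deduplicate-Unique _)
               (All.deduplicate⁺ _≟ₛ_ (All.map⁺ (All.tabulate λ g∈F → trace⊆ g∈F , ∣e∩f∣≡j g∈F))))
    where
    traces : List (Subset n)
    traces = deduplicate _≟ₛ_ (map (e ∩_) F)
    trace-covers : g ∈ F → e ∩ g ⊆ f → Covers traces f
    trace-covers {g} g∈F e∩g⊆f = e ∩ g , ∈-deduplicate⁺ _≟ₛ_ (∈-map⁺ (e ∩_) g∈F) , e∩g⊆f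

  Twins : Subset n → Subset n → Set
  Twins f₁ f₂ = f₁ ∈ F × f₂ ∈ F × f₁ ≢ f₂ × e ∩ f₁ ≡ e ∩ f₂

  twin-avoidance : ∀ {f₁ f₂} → Twins f₁ f₂ → g ∈ F → ∃[ v ] (v ∈ₛ e ─ f₁ × v ∉ₛ g)
  twin-avoidance {g} {f₁} {f₂} (f₁∈F , f₂∈F , f₁≢f₂ , same) g∈F = ⊈⇒∃∉ λ e─f₁⊆g → f₁≢f₂ (begin
    f₁                   ≡⟨ p∩q∪q─p≡q e f₁ ⟨
    (e ∩ f₁) ∪ (f₁ ─ e)  ≡⟨ cong₂ _∪_ same (trans (outside-agrees f₁∈F e─f₁⊆g)
                                                  (sym (outside-agrees f₂∈F (e─f₂⊆g e─f₁⊆g)))) ⟩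
    (e ∩ f₂) ∪ (f₂ ─ e)  ≡⟨ p∩q∪q─p≡q e f₂ ⟩
    f₂                   ∎)
    where
    open ≡-Reasoning
    e─f₂⊆g : e ─ f₁ ⊆ g → e ─ f₂ ⊆ g
    e─f₂⊆g = subst (_⊆ g) (p∩q≡p∩r⇒p─q≡p─r e same)
    outside-agrees : f ∈ F → e ─ f ⊆ g → f ─ e ≡ g ─ e
    outside-agrees f∈F e─f⊆g =
      e⊆f∪g⇒f─e≡g─e ∣e∣≡2+j (∣f∣≡2+j (F⊆E f∈F)) (∣f∣≡2+j (F⊆E g∈F)) (j≤∣f∩g∣ (F⊆E f∈F) (F⊆E g∈F))
                    (∣f─e∣≡2 f∈F) (∣f─e∣≡2 g∈F) (p─q⊆r⇒p⊆q∪r e─f⊆g)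

  module _ {f₁ f₂} (twins : Twins f₁ f₂) where

    private
      f₁∈F = proj₁ twins

    F′ : List (Subset n)
    F′ = filter (λ g → ¬? (e ∩ g ≟ₛ e ∩ f₁)) F

    F′⊆E : g ∈ F′ → g ∈ E
    F′⊆E = F⊆E ∘ proj₁ ∘ ∈-filter⁻ _

    τ≤-distinct-other-traces : Unique (map (e ∩_) F′) → τ≤ H (2 + j)
    τ≤-distinct-other-traces distinct
      with a , a∈D ← 0<∣p∣⇒nonempty {p = e ─ f₁} (subst (0 <_) (sym (∣e─f∣≡2 f₁∈F)) z<s)
      with b , b∈D , _ , D∖a⊆b ← ∣p∣≡2⇒partner (∣e─f∣≡2 f₁∈F) a∈D
      with cs , ∣cs∣ , covers , len ← pairing-cover j F′ (λ g∈ h∈ → j≤∣f∩g∣ (F′⊆E g∈) (F′⊆E h∈))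
      = τ≤-intro H (e ∩ f₁ ∷ cs) (∣e∩f∣≡j f₁∈F ∷ ∣cs∣)
                 (covers-E (e ∩ f₁ , Any.here refl , p∩q⊆p e f₁) covers-F) (s≤s ∣cs∣≤1+j)
      where
      covers-F : g ∈ F → Covers (e ∩ f₁ ∷ cs) g
      covers-F {g} g∈F with e ∩ g ≟ₛ e ∩ f₁
      ... | yes same = e ∩ f₁ , Any.here refl , subst (_⊆ g) same (p∩q⊆q e g)
      ... | no differ = map₂ (map₁ Any.there) (All.lookup covers (∈-filter⁺ _ g∈F differ))
      trace⊆ : g ∈ F′ → (e ∩ g ⊆ e - a ⊎ e ∩ g ⊆ e - b) × ∣ e ∩ g ∣ ≡ j
      trace⊆ {g} g∈F′ with g∈F , _ ← ∈-filter⁻ _ g∈F′ with a ∈? g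
      ... | no a∉g = inj₁ (x∉q⇒p∩q⊆p-x a∉g) , ∣e∩f∣≡j g∈F
      ... | yes a∈g = inj₂ (x∉q⇒p∩q⊆p-x (missed-partner D∖a⊆b (twin-avoidance twins g∈F) a∈g))
                      , ∣e∩f∣≡j g∈F
      ∣e-x∣Cj : ∀ {x} → x ∈ₛ e ─ f₁ → ∣ e - x ∣ C j ≡ suc j
      ∣e-x∣Cj x∈D = trans (cong (_C j) (∣e-x∣≡1+j (p─q⊆p e f₁ x∈D))) ([1+n]Cn≡1+n j)
      ∣cs∣≤1+j : length cs ≤ suc j
      ∣cs∣≤1+j = begin
        length cs                        ≤⟨ len ⟩
        ⌈ length F′ /2⌉                  ≡⟨ cong ⌈_/2⌉ (length-map (e ∩_) F′) ⟨
        ⌈ length (map (e ∩_) F′) /2⌉     ≤⟨ ⌈n/2⌉-mono (length≤∣s∣Cr+∣t∣Cr (e - a) (e - b) j distinct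
                                                          (All.map⁺ (All.tabulate trace⊆))) ⟩
        ⌈ ∣ e - a ∣ C j + ∣ e - b ∣ C j /2⌉
                                         ≡⟨ cong₂ (λ m m′ → ⌈ m + m′ /2⌉) (∣e-x∣Cj a∈D) (∣e-x∣Cj b∈D) ⟩
        ⌈ suc j + suc j /2⌉              ≡⟨ n≡⌈n+n/2⌉ (suc j) ⟨
        suc j                            ∎
        where open ≤-Reasoning

    τ≤-two-twin-pairs : ∀ {g₁ g₂} → Twins g₁ g₂ → e ∩ g₁ ≢ e ∩ f₁ → τ≤ H (2 + j)
    τ≤-two-twin-pairs {g₁} twins′@(g₁∈F , _) differ
      with u , u∈D , u∉g₁ ← twin-avoidance twins g₁∈F
      with u∈D′ ← x∈p∧x∉q⇒x∈p─q (p─q⊆p e f₁ u∈D) u∉g₁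
      with w , w∈D , _ , D∖u⊆w ← ∣p∣≡2⇒partner (∣e─f∣≡2 f₁∈F) u∈D
      with c , c∈D′ , _ , D′∖u⊆c ← ∣p∣≡2⇒partner (∣e─f∣≡2 g₁∈F) u∈D′
      = τ≤-mono H (τ≤-traces f₁∈F trace⊆) (≤-reflexive count)
      where
      w≢c : w ≢ c
      w≢c refl = differ (sym (p─q≡p─r⇒p∩q≡p∩r e (p⊆q⇒∣q∣≤∣p∣⇒p≡q D⊆D′ (≤-reflexive ∣D′∣≡∣D∣))))
        where
        ∣D′∣≡∣D∣ = trans (∣e─f∣≡2 g₁∈F) (sym (∣e─f∣≡2 f₁∈F))
        D⊆D′ : e ─ f₁ ⊆ e ─ g₁
        D⊆D′ {z} z∈D with z Fin.≟ u
        ... | yes refl = u∈D′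
        ... | no z≢u = subst (_∈ₛ e ─ g₁) (sym (D∖u⊆w z∈D z≢u)) c∈D′
      trace⊆ : g ∈ F → e ∩ g ⊆ e - u ⊎ e ∩ g ⊆ e - w - c
      trace⊆ {g} g∈F with u ∈? g
      ... | no u∉g = inj₁ (x∉q⇒p∩q⊆p-x u∉g)
      ... | yes u∈g = inj₂ (x∉q⇒y∉q⇒p∩q⊆p-x-y (missed-partner D∖u⊆w (twin-avoidance twins g∈F) u∈g)
                                              (missed-partner D′∖u⊆c (twin-avoidance twins′ g∈F) u∈g))
      ∣e-w-c∣≡j : ∣ e - w - c ∣ ≡ j
      ∣e-w-c∣≡j = suc-injective (trans (x∈p⇒suc∣p-x∣≡∣p∣ c∈e-w) (∣e-x∣≡1+j (p─q⊆p e f₁ w∈D)))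
        where c∈e-w = x∈p∧x≢y⇒x∈p-y (p─q⊆p e g₁ c∈D′) (w≢c ∘ sym)
      count : ∣ e - u ∣ C j + ∣ e - w - c ∣ C j ≡ 2 + j
      count = begin
        ∣ e - u ∣ C j + ∣ e - w - c ∣ C j  ≡⟨ cong₂ (λ m m′ → m C j + m′ C j)
                                                    (∣e-x∣≡1+j (p─q⊆p e f₁ u∈D)) ∣e-w-c∣≡j ⟩
        suc j C j + j C j                  ≡⟨ cong₂ _+_ ([1+n]Cn≡1+n j) (nCn≡1 j) ⟩
        suc j + 1                          ≡⟨ +-comm (suc j) 1 ⟩
        2 + j                              ∎
        where open ≡-Reasoning

    τ≤-twins : τ≤ H (2 + j)
    τ≤-twins with Unique-map⊎Collision _≟ₛ_ (e ∩_) (Unique.filter⁺ _ F-unique)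
    ... | inj₁ distinct = τ≤-distinct-other-traces distinct
    ... | inj₂ (g₁ , g₂ , g₁∈F′ , g₂∈F′ , g₁≢g₂ , same) =
      let g₁∈F , differ = ∈-filter⁻ _ g₁∈F′ in
      τ≤-two-twin-pairs (g₁∈F , proj₁ (∈-filter⁻ _ g₂∈F′) , g₁≢g₂ , same) differ

  τ≤bound : 2 ≤ j → τ≤ H (bound (2 + j))
  τ≤bound 2≤j with Unique-map⊎Collision _≟ₛ_ (e ∩_) F-unique
  ... | inj₁ distinct = τ≤-distinct-traces distinct
  ... | inj₂ (_ , _ , twins) = τ≤-mono H (τ≤-twins twins) (4≤k⇒k≤bound (s≤s (s≤s 2≤j)))

lemma10 : (k n : ℕ) → 5 ≤ k → (H : Hypergraph n k) → νEq H 1 →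
    (∃[ e ] (e ∈ edges H × (∀ f → f ∈ edges H → ¬ f ≡ e → ∣ e ∩ f ∣ ≡ k ∸ 2))) →
    τ≤ H (bound k)
lemma10 k n 5≤k H ν (e , e∈H , pivot) with m≤n⇒∃[o]m+o≡n 5≤k
... | i , refl = Pivot.τ≤bound H ν e∈H pivot (s≤s (s≤s z≤n))
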